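{- In each of the systems $\mathcal{I}_\omega$ and $\mathcal{I}_0$ the following rules are admissible (if the premises are derivable then so is the conclusion), for all finite sets of terms $\Gamma$ and terms $t,t',t_1,t_2$: $(P_e)$ from $\Gamma\vdash t_1\supset t_2$ and $\Gamma\vdash t_1$ infer $\Gamma\vdash t_2$; $(P_i)$ from $\Gamma,t_1\vdash t_2$ and $\Gamma\vdash Ht_1$ infer $\Gamma\vdash t_1\supset t_2$; $(P_H)$ from $\Gamma,t_1\vdash Ht_2$ and $\Gamma\vdash Ht_1$ infer $\Gamma\vdash H(t_1\supset t_2)$; (Weak) from $\Gamma\vdash t$ infer $\Gamma,t'\vdash t$.
   Context: Let $\mathcal{B}$ be a finite set of base types and $\Sigma$ a set of constants containing $\Xi$, $L$, and $A_\tau$ for each $\tau\in\mathcal{B}$. Terms are type-free $\lambda$-terms over $\Sigma$, up to $\alpha$-conversion. Abbreviations: $K\equiv\lambda xy.x$, $H\equiv\lambda x.L(Kx)$, $t_1\supset t_2\equiv(\lambda xy.\Xi(Kx)(Ky))t_1t_2$, $F\equiv\lambda xyf.\Xi x(\lambda z.y(fz))$. Judgements $\Gamma\vdash t$, $\Gamma$ a finite set of terms, $\Gamma,t$ meaning $\Gamma\cup\{t\}$. $\mathcal{I}_\omega$: axioms $\Gamma,t\vdash t$; $\Gamma\vdash LH$; $\Gamma\vdash LA_\tau$ ($\tau\in\mathcal{B}$); rules: (Eq) from $\Gamma\vdash t_1$, $t_1=_{\beta\eta}t_2$ infer $\Gamma\vdash t_2$; $(H_i)$ from $\Gamma\vdash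 t$ infer $\Gamma\vdash Ht$; $(\Xi_e)$ from $\Gamma\vdash\Xi t_1t_2$, $\Gamma\vdash t_1t_3$ infer $\Gamma\vdash t_2t_3$; $(\Xi_i)$ from $\Gamma,t_1x\vdash t_2x$, $\Gamma\vdash Lt_1$ infer $\Gamma\vdash\Xi t_1t_2$; $(\Xi_H)$ from $\Gamma,t_1x\vdash H(t_2x)$, $\Gamma\vdash Lt_1$ infer $\Gamma\vdash H(\Xi t_1t_2)$; $(F_L)$ from $\Gamma,t_1x\vdash Lt_2$, $\Gamma\vdash Lt_1$ infer $\Gamma\vdash L(Ft_1t_2)$; with $x$ not free in $\Gamma,t_1,t_2$ in the last three. $\mathcal{I}_0$ is $\mathcal{I}_\omega$ without $(F_L)$. -}

module Defs where

open import Data.Nat using (ℕ; zero; suc)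
open import Data.Fin using (Fin)
open import Data.List using (List; _∷_)
open import Data.List.Membership.Propositional using (_∈_)
open import Data.List.Relation.Unary.All using (All)
open import Relation.Nullary using (¬_)
open import Relation.Binary.PropositionalEquality using (_≡_)

-- Type-free λ-terms over Σ, up to α-conversion (de Bruijn indices).
-- Base types: B = Fin n (an arbitrary finite set).

data Term (n : ℕ) (C : Set) : Set where
  var : ℕ → Term n C
  app : Term n C → Term n C → Term n C
  lam : Term n C → Term n C
  Ξ   : Term n C
  L   : Term n C
  A   : Fin n → Term n C
  con : C → Term n C

infixl 9 _·_
_·_ : ∀ {n C} → Term n C → Term n C → Term n C
_·_ = app

module _ {n : ℕ} {C : Set} where

  ext : (ℕ → ℕ) → ℕ → ℕ
  ext ρ zero    = zero
  ext ρ (suc k) = suc (ρ k)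

  rename : (ℕ → ℕ) → Term n C → Term n C
  rename ρ (var k)   = var (ρ k)
  rename ρ (app t u) = app (rename ρ t) (rename ρ u)
  rename ρ (lam t)   = lam (rename (ext ρ) t)
  rename ρ Ξ         = Ξ
  rename ρ L         = L
  rename ρ (A τ)     = A τ
  rename ρ (con c)   = con c

  exts : (ℕ → Term n C) → ℕ → Term n C
  exts σ zero    = var zero
  exts σ (suc k) = rename suc (σ k)

  subst : (ℕ → Term n C) → Term n C → Term n C
  subst σ (var k)   = σ k
  subst σ (app t u) = app (subst σ t) (subst σ u)
  subst σ (lam t)   = lam (subst (exts σ) t)
  subst σ Ξ         = Ξ
  subst σ L         = L
  subst σ (A τ)     = A τ
  subst σ (con c)   = con c

  -- substitute for variable 0 (and lower the other free variables)
  single : Term n C → ℕ → Term n C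
  single u zero    = u
  single u (suc k) = var k

  _[_] : Term n C → Term n C → Term n C
  t [ u ] = subst (single u) t

  data _⟶_ : Term n C → Term n C → Set where
    β    : ∀ {t u} → app (lam t) u ⟶ (t [ u ])
    η    : ∀ {t} → lam (app (rename suc t) (var zero)) ⟶ t
    appˡ : ∀ {t t' u} → t ⟶ t' → app t u ⟶ app t' u
    appʳ : ∀ {t u u'} → u ⟶ u' → app t u ⟶ app t u'
    lamᶜ : ∀ {t t'} → t ⟶ t' → lam t ⟶ lam t'

  data _=βη_ : Term n C → Term n C → Set where
    step   : ∀ {t u} → t ⟶ u → t =βη u
    refl   : ∀ {t} → t =βη t
    sym    : ∀ {t u} → t =βη u → u =βη t
    trans  : ∀ {t u v} → t =βη u → u =βη v → t =βη v

  data FreeIn : ℕ → Term n C → Set where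
    here : ∀ {x} → FreeIn x (var x)
    inˡ  : ∀ {x t u} → FreeIn x t → FreeIn x (app t u)
    inʳ  : ∀ {x t u} → FreeIn x u → FreeIn x (app t u)
    inλ  : ∀ {x t} → FreeIn (suc x) t → FreeIn x (lam t)

  Fresh : ℕ → Term n C → Set
  Fresh x t = ¬ FreeIn x t

  K : Term n C
  K = lam (lam (var 1))

  H : Term n C
  H = lam (L · (K · var 0))

  infixr 5 _⊃_
  _⊃_ : Term n C → Term n C → Term n C
  t₁ ⊃ t₂ = lam (lam (Ξ · (K · var 1) · (K · var 0))) · t₁ · t₂

  F : Term n C
  F = lam (lam (lam (Ξ · var 2 · lam (var 2 · (var 1 · var 0)))))

  -- Contexts: finite sets of terms, represented by lists
  -- (Γ , t is t ∷ Γ; all rules only inspect membership).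
  Ctx : Set
  Ctx = List (Term n C)

data System : Set where
  Iω I0 : System

module _ {n : ℕ} {C : Set} where

  data _⊢[_]_ : Ctx {n} {C} → System → Term n C → Set where
    ax   : ∀ {s Γ t} → t ∈ Γ → Γ ⊢[ s ] t
    axLH : ∀ {s Γ} → Γ ⊢[ s ] (L · H)
    axLA : ∀ {s Γ} (τ : Fin n) → Γ ⊢[ s ] (L · A τ)
    Eq   : ∀ {s Γ t₁ t₂} → Γ ⊢[ s ] t₁ → t₁ =βη t₂ → Γ ⊢[ s ] t₂
    Hᵢ   : ∀ {s Γ t} → Γ ⊢[ s ] t → Γ ⊢[ s ] (H · t)
    Ξₑ   : ∀ {s Γ t₁ t₂ t₃} → Γ ⊢[ s ] (Ξ · t₁ · t₂) → Γ ⊢[ s ] (t₁ · t₃)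
           → Γ ⊢[ s ] (t₂ · t₃)
    Ξᵢ   : ∀ {s Γ t₁ t₂} (x : ℕ) → All (Fresh x) Γ → Fresh x t₁ → Fresh x t₂
           → ((t₁ · var x) ∷ Γ) ⊢[ s ] (t₂ · var x) → Γ ⊢[ s ] (L · t₁)
           → Γ ⊢[ s ] (Ξ · t₁ · t₂)
    Ξ_H  : ∀ {s Γ t₁ t₂} (x : ℕ) → All (Fresh x) Γ → Fresh x t₁ → Fresh x t₂
           → ((t₁ · var x) ∷ Γ) ⊢[ s ] (H · (t₂ · var x)) → Γ ⊢[ s ] (L · t₁)
           → Γ ⊢[ s ] (H · (Ξ · t₁ · t₂))
    F_L  : ∀ {s Γ t₁ t₂} → s ≡ Iω → (x : ℕ) → All (Fresh x) Γ → Fresh x t₁ → Fresh x t₂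
           → ((t₁ · var x) ∷ Γ) ⊢[ s ] (L · t₂) → Γ ⊢[ s ] (L · t₁)
           → Γ ⊢[ s ] (L · (F · t₁ · t₂))

-- The only non-trivial ingredient is a structural lemma about derivations:
-- renaming free variables and replacing hypotheses by βη-equal ones
-- preserves derivability (`rename-⊢`).  Its proof is an induction on the
-- derivation; at the three rules that bind an eigenvariable x, x is sent to a
-- variable y chosen fresh for the new context and side terms.
--
-- Weakening and "conversion of a hypothesis" are the identity-renaming
-- instances of `rename-⊢`.  The implication rules then follow by unfolding
-- t₁ ⊃ t₂ =βη Ξ(Kt₁)(Kt₂) and H t =βη L(Kt):  (Pₑ) is (Ξₑ) applied to an
-- arbitrary argument, while (Pᵢ) and (P_H) are (Ξᵢ) and (Ξ_H) at a fresh
-- variable x, using that the hypothesis K t₁ x is βη-equal to t₁.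

module Submission where

open import Defs
open import Data.Nat using (ℕ; zero; suc; _⊔_; _≤_; _<_; pred; s≤s)
open import Data.Nat.Properties using (_≟_; ≤-trans; ≤-refl; m≤m⊔n; m≤n⊔m; <-irrefl)
open import Data.Product using (_×_; _,_; Σ-syntax)
open import Data.List using (List; _∷_; [])
open import Data.List.Membership.Propositional using (_∈_)
open import Data.List.Relation.Unary.Any using (here; there)
open import Data.List.Relation.Unary.All as All using (All; []; _∷_)
open import Data.Empty using (⊥-elim)
open import Relation.Nullary using (yes; no)
import Relation.Binary.PropositionalEquality as P
open P using (_≡_)
open P.≡-Reasoning

module _ {n : ℕ} {C : Set} where

  private
    T : Set
    T = Term n C

    -- `ext` from Defs, with the (otherwise uninferable) parameters fixed.
    ⇑ : (ℕ → ℕ) → ℕ → ℕ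
    ⇑ = ext {n} {C}

  ≡⇒=βη : {t u : T} → t ≡ u → t =βη u
  ≡⇒=βη P.refl = refl

  rename-cong : (ρ ρ' : ℕ → ℕ) (t : T) → (∀ k → FreeIn k t → ρ k ≡ ρ' k)
    → rename ρ t ≡ rename ρ' t
  rename-cong ρ ρ' (var x)   h = P.cong var (h x here)
  rename-cong ρ ρ' (app t u) h = P.cong₂ app (rename-cong ρ ρ' t (λ k f → h k (inˡ f)))
                                             (rename-cong ρ ρ' u (λ k f → h k (inʳ f)))
  rename-cong ρ ρ' (lam t)   h = P.cong lam (rename-cong (⇑ ρ) (⇑ ρ') t h')
    where
    h' : ∀ k → FreeIn k t → ⇑ ρ k ≡ ⇑ ρ' k
    h' zero    f = P.refl
    h' (suc k) f = P.cong suc (h k (inλ f))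
  rename-cong ρ ρ' Ξ       h = P.refl
  rename-cong ρ ρ' L       h = P.refl
  rename-cong ρ ρ' (A τ)   h = P.refl
  rename-cong ρ ρ' (con c) h = P.refl

  rename-id : (ρ : ℕ → ℕ) (t : T) → (∀ k → ρ k ≡ k) → rename ρ t ≡ t
  rename-id ρ (var x)   h = P.cong var (h x)
  rename-id ρ (app t u) h = P.cong₂ app (rename-id ρ t h) (rename-id ρ u h)
  rename-id ρ (lam t)   h = P.cong lam (rename-id (⇑ ρ) t h')
    where
    h' : ∀ k → ⇑ ρ k ≡ k
    h' zero    = P.refl
    h' (suc k) = P.cong suc (h k)
  rename-id ρ Ξ       h = P.refl
  rename-id ρ L       h = P.refl
  rename-id ρ (A τ)   h = P.refl
  rename-id ρ (con c) h = P.refl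

  rename-idᶠ : (t : T) → rename (λ k → k) t ≡ t
  rename-idᶠ t = rename-id (λ k → k) t (λ _ → P.refl)

  rename-fuse : (ρ ρ' ρ'' : ℕ → ℕ) (t : T) → (∀ k → ρ (ρ' k) ≡ ρ'' k)
    → rename ρ (rename ρ' t) ≡ rename ρ'' t
  rename-fuse ρ ρ' ρ'' (var x)   h = P.cong var (h x)
  rename-fuse ρ ρ' ρ'' (app t u) h = P.cong₂ app (rename-fuse ρ ρ' ρ'' t h) (rename-fuse ρ ρ' ρ'' u h)
  rename-fuse ρ ρ' ρ'' (lam t)   h = P.cong lam (rename-fuse (⇑ ρ) (⇑ ρ') (⇑ ρ'') t h')
    where
    h' : ∀ k → ⇑ ρ (⇑ ρ' k) ≡ ⇑ ρ'' k
    h' zero    = P.refl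
    h' (suc k) = P.cong suc (h k)
  rename-fuse ρ ρ' ρ'' Ξ       h = P.refl
  rename-fuse ρ ρ' ρ'' L       h = P.refl
  rename-fuse ρ ρ' ρ'' (A τ)   h = P.refl
  rename-fuse ρ ρ' ρ'' (con c) h = P.refl

  ⇑-shift : (ρ : ℕ → ℕ) (t : T) → rename (⇑ ρ) (rename suc t) ≡ rename suc (rename ρ t)
  ⇑-shift ρ t = begin
    rename (⇑ ρ) (rename suc t)  ≡⟨ rename-fuse (⇑ ρ) suc (λ j → suc (ρ j)) t (λ _ → P.refl) ⟩
    rename (λ j → suc (ρ j)) t     ≡⟨ P.sym (rename-fuse suc ρ (λ j → suc (ρ j)) t (λ _ → P.refl)) ⟩
    rename suc (rename ρ t)        ∎

  rename-subst : (ρ ρ' : ℕ → ℕ) (σ τ : ℕ → T) (t : T) → (∀ k → rename ρ (σ k) ≡ τ (ρ' k))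
    → rename ρ (subst σ t) ≡ subst τ (rename ρ' t)
  rename-subst ρ ρ' σ τ (var x)   h = h x
  rename-subst ρ ρ' σ τ (app t u) h = P.cong₂ app (rename-subst ρ ρ' σ τ t h) (rename-subst ρ ρ' σ τ u h)
  rename-subst ρ ρ' σ τ (lam t)   h = P.cong lam (rename-subst (⇑ ρ) (⇑ ρ') (exts σ) (exts τ) t h')
    where
    h' : ∀ k → rename (⇑ ρ) (exts σ k) ≡ exts τ (⇑ ρ' k)
    h' zero    = P.refl
    h' (suc k) = P.trans (⇑-shift ρ (σ k)) (P.cong (rename suc) (h k))
  rename-subst ρ ρ' σ τ Ξ       h = P.refl
  rename-subst ρ ρ' σ τ L       h = P.refl
  rename-subst ρ ρ' σ τ (A τ')  h = P.refl
  rename-subst ρ ρ' σ τ (con c) h = P.refl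

  subst-rename : (σ τ : ℕ → T) (ρ : ℕ → ℕ) (t : T) → (∀ k → σ (ρ k) ≡ τ k)
    → subst σ (rename ρ t) ≡ subst τ t
  subst-rename σ τ ρ (var x)   h = h x
  subst-rename σ τ ρ (app t u) h = P.cong₂ app (subst-rename σ τ ρ t h) (subst-rename σ τ ρ u h)
  subst-rename σ τ ρ (lam t)   h = P.cong lam (subst-rename (exts σ) (exts τ) (⇑ ρ) t h')
    where
    h' : ∀ k → exts σ (⇑ ρ k) ≡ exts τ k
    h' zero    = P.refl
    h' (suc k) = P.cong (rename suc) (h k)
  subst-rename σ τ ρ Ξ       h = P.refl
  subst-rename σ τ ρ L       h = P.refl
  subst-rename σ τ ρ (A τ')  h = P.refl
  subst-rename σ τ ρ (con c) h = P.refl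

  subst-id : (σ : ℕ → T) (t : T) → (∀ k → σ k ≡ var k) → subst σ t ≡ t
  subst-id σ (var x)   h = h x
  subst-id σ (app t u) h = P.cong₂ app (subst-id σ t h) (subst-id σ u h)
  subst-id σ (lam t)   h = P.cong lam (subst-id (exts σ) t h')
    where
    h' : ∀ k → exts σ k ≡ var k
    h' zero    = P.refl
    h' (suc k) = P.cong (rename suc) (h k)
  subst-id σ Ξ       h = P.refl
  subst-id σ L       h = P.refl
  subst-id σ (A τ)   h = P.refl
  subst-id σ (con c) h = P.refl

  shift-[] : (t u : T) → (rename suc t) [ u ] ≡ t
  shift-[] t u = P.trans (subst-rename (single u) var suc t (λ _ → P.refl))
                         (subst-id var t (λ _ → P.refl))

  rename-⟶ : (ρ : ℕ → ℕ) {t u : T} → t ⟶ u → rename ρ t ⟶ rename ρ u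
  rename-⟶ ρ (β {t} {u}) =
    P.subst (app (lam (rename (⇑ ρ) t)) (rename ρ u) ⟶_)
            (P.sym (rename-subst ρ (⇑ ρ) (single u) (single (rename ρ u)) t commute)) β
    where
    commute : ∀ k → rename ρ (single u k) ≡ single (rename ρ u) (⇑ ρ k)
    commute zero    = P.refl
    commute (suc k) = P.refl
  rename-⟶ ρ (η {t}) = P.subst (λ z → lam (app z (var zero)) ⟶ rename ρ t) (P.sym (⇑-shift ρ t)) η
  rename-⟶ ρ (appˡ r) = appˡ (rename-⟶ ρ r)
  rename-⟶ ρ (appʳ r) = appʳ (rename-⟶ ρ r)
  rename-⟶ ρ (lamᶜ r) = lamᶜ (rename-⟶ (⇑ ρ) r)

  rename-=βη : (ρ : ℕ → ℕ) {t u : T} → t =βη u → rename ρ t =βη rename ρ u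
  rename-=βη ρ (step r)    = step (rename-⟶ ρ r)
  rename-=βη ρ refl        = refl
  rename-=βη ρ (sym e)     = sym (rename-=βη ρ e)
  rename-=βη ρ (trans e f) = trans (rename-=βη ρ e) (rename-=βη ρ f)

  appʳ-=βη : (t : T) {u u' : T} → u =βη u' → app t u =βη app t u'
  appʳ-=βη t (step r)    = step (appʳ r)
  appʳ-=βη t refl        = refl
  appʳ-=βη t (sym e)     = sym (appʳ-=βη t e)
  appʳ-=βη t (trans e f) = trans (appʳ-=βη t e) (appʳ-=βη t f)

  -- A strict upper bound on the free variables of a term, and of a context;
  -- every variable at or above it is fresh.
  varBound : T → ℕ
  varBound (var x)   = suc x
  varBound (app t u) = varBound t ⊔ varBound u
  varBound (lam t)   = pred (varBound t)
  varBound Ξ         = 0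
  varBound L         = 0
  varBound (A τ)     = 0
  varBound (con c)   = 0

  free<varBound : ∀ {k} (t : T) → FreeIn k t → k < varBound t
  free<varBound (var x)   here    = ≤-refl
  free<varBound (app t u) (inˡ f) = ≤-trans (free<varBound t f) (m≤m⊔n _ _)
  free<varBound (app t u) (inʳ f) = ≤-trans (free<varBound u f) (m≤n⊔m _ _)
  free<varBound (lam t)   (inλ f) with varBound t | free<varBound t f
  ... | suc b | s≤s k<b = k<b

  ctxBound : List T → ℕ
  ctxBound []      = 0
  ctxBound (t ∷ Γ) = varBound t ⊔ ctxBound Γ

  fresh-above : ∀ {y} (Γ : List T) → ctxBound Γ ≤ y → All (Fresh y) Γ
  fresh-above []      le = []
  fresh-above (t ∷ Γ) le =
    (λ f → <-irrefl P.refl (≤-trans (free<varBound t f) (≤-trans (m≤m⊔n _ _) le)))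
    ∷ fresh-above Γ (≤-trans (m≤n⊔m _ _) le)

  freshFor : (Γ : List T) → All (Fresh (ctxBound Γ)) Γ
  freshFor Γ = fresh-above Γ ≤-refl

  _[_↦_] : (ℕ → ℕ) → ℕ → ℕ → ℕ → ℕ
  (ρ [ x ↦ y ]) k with k ≟ x
  ... | yes _ = y
  ... | no  _ = ρ k

  ↦-here : ∀ ρ x y → (ρ [ x ↦ y ]) x ≡ y
  ↦-here ρ x y with x ≟ x
  ... | yes _  = P.refl
  ... | no x≢x = ⊥-elim (x≢x P.refl)

  ↦-fresh : ∀ ρ x y (t : T) → Fresh x t → rename ρ t ≡ rename (ρ [ x ↦ y ]) t
  ↦-fresh ρ x y t fr = rename-cong ρ (ρ [ x ↦ y ]) t agree
    where
    agree : ∀ k → FreeIn k t → ρ k ≡ (ρ [ x ↦ y ]) k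
    agree k f with k ≟ x
    ... | yes P.refl = ⊥-elim (fr f)
    ... | no  _      = P.refl

  _≼[_]_ : List T → (ℕ → ℕ) → List T → Set
  Γ ≼[ ρ ] Δ = ∀ {u} → u ∈ Γ → Σ[ u' ∈ T ] (u' ∈ Δ × u' =βη rename ρ u)

  -- The eigenvariable case of `rename-⊢`: for a rule with premise context
  -- (t₁ x ∷ Γ), the eigenvariable x is renamed to y, fresh for Δ and for the
  -- renamed side terms; the updated renaming ρ' agrees with ρ on Γ, t₁, t₂.
  module Eigenvariable {Γ : List T} {t₁ t₂ : T} (x : ℕ) (fΓ : All (Fresh x) Γ)
           (f₁ : Fresh x t₁) (f₂ : Fresh x t₂) (ρ : ℕ → ℕ) (Δ : List T) (Γ≼Δ : Γ ≼[ ρ ] Δ) where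

    y : ℕ
    y = ctxBound (rename ρ t₁ ∷ rename ρ t₂ ∷ Δ)

    fresh-y : All (Fresh y) (rename ρ t₁ ∷ rename ρ t₂ ∷ Δ)
    fresh-y = freshFor (rename ρ t₁ ∷ rename ρ t₂ ∷ Δ)

    fresh-y₁ : Fresh y (rename ρ t₁)
    fresh-y₁ = All.head fresh-y

    fresh-y₂ : Fresh y (rename ρ t₂)
    fresh-y₂ = All.head (All.tail fresh-y)

    fresh-yΔ : All (Fresh y) Δ
    fresh-yΔ = All.tail (All.tail fresh-y)

    ρ' : ℕ → ℕ
    ρ' = ρ [ x ↦ y ]

    t₂-unchanged : rename ρ' t₂ ≡ rename ρ t₂
    t₂-unchanged = P.sym (↦-fresh ρ x y t₂ f₂)

    x↦y : var {n} {C} (ρ' x) ≡ var y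
    x↦y = P.cong var (↦-here ρ x y)

    Δ' : List T
    Δ' = (rename ρ t₁ · var y) ∷ Δ

    premise≼ : ((t₁ · var x) ∷ Γ) ≼[ ρ' ] Δ'
    premise≼ (here P.refl) =
      _ , here P.refl , ≡⇒=βη (P.cong₂ app (↦-fresh ρ x y t₁ f₁) (P.sym x↦y))
    premise≼ (there m) with Γ≼Δ m
    ... | u' , m' , e = u' , there m' , P.subst (u' =βη_) (↦-fresh ρ x y _ (All.lookup fΓ m)) e

    premise-goal : rename ρ' (t₂ · var x) ≡ rename ρ t₂ · var y
    premise-goal = P.cong₂ app t₂-unchanged x↦y

  rename-⊢ : ∀ {s Γ t} → Γ ⊢[ s ] t → ∀ ρ Δ → Γ ≼[ ρ ] Δ → Δ ⊢[ s ] rename ρ t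
  rename-⊢ (ax m) ρ Δ Γ≼Δ with Γ≼Δ m
  ... | u' , m' , e = Eq (ax m') e
  rename-⊢ axLH         ρ Δ Γ≼Δ = axLH
  rename-⊢ (axLA τ)     ρ Δ Γ≼Δ = axLA τ
  rename-⊢ (Eq d e)     ρ Δ Γ≼Δ = Eq (rename-⊢ d ρ Δ Γ≼Δ) (rename-=βη ρ e)
  rename-⊢ (Hᵢ d)       ρ Δ Γ≼Δ = Hᵢ (rename-⊢ d ρ Δ Γ≼Δ)
  rename-⊢ (Ξₑ d d₁)    ρ Δ Γ≼Δ = Ξₑ (rename-⊢ d ρ Δ Γ≼Δ) (rename-⊢ d₁ ρ Δ Γ≼Δ)
  rename-⊢ (Ξᵢ {s} x fΓ f₁ f₂ d dL) ρ Δ Γ≼Δ =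
    Ξᵢ y fresh-yΔ fresh-y₁ fresh-y₂
       (P.subst (Δ' ⊢[ s ]_) premise-goal (rename-⊢ d ρ' Δ' premise≼))
       (rename-⊢ dL ρ Δ Γ≼Δ)
    where open Eigenvariable x fΓ f₁ f₂ ρ Δ Γ≼Δ
  rename-⊢ (Ξ_H {s} x fΓ f₁ f₂ d dL) ρ Δ Γ≼Δ =
    Ξ_H y fresh-yΔ fresh-y₁ fresh-y₂
        (P.subst (λ z → Δ' ⊢[ s ] (H · z)) premise-goal (rename-⊢ d ρ' Δ' premise≼))
        (rename-⊢ dL ρ Δ Γ≼Δ)
    where open Eigenvariable x fΓ f₁ f₂ ρ Δ Γ≼Δ
  rename-⊢ (F_L {s} s≡Iω x fΓ f₁ f₂ d dL) ρ Δ Γ≼Δ =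
    F_L s≡Iω y fresh-yΔ fresh-y₁ fresh-y₂
        (P.subst (λ z → Δ' ⊢[ s ] (L · z)) t₂-unchanged (rename-⊢ d ρ' Δ' premise≼))
        (rename-⊢ dL ρ Δ Γ≼Δ)
    where open Eigenvariable x fΓ f₁ f₂ ρ Δ Γ≼Δ

  ⊢-covered : ∀ {s Γ Δ t} → (∀ {u} → u ∈ Γ → Σ[ u' ∈ T ] (u' ∈ Δ × u' =βη u))
    → Γ ⊢[ s ] t → Δ ⊢[ s ] t
  ⊢-covered {s} {Δ = Δ} {t} cover d =
    P.subst (Δ ⊢[ s ]_) (rename-idᶠ t) (rename-⊢ d (λ k → k) Δ cover-id)
    where
    cover-id : ∀ {u} → u ∈ _ → Σ[ u' ∈ T ] (u' ∈ Δ × u' =βη rename (λ k → k) u)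
    cover-id {u} m with cover m
    ... | u' , m' , e = u' , m' , trans e (≡⇒=βη (P.sym (rename-idᶠ u)))

  weakening : ∀ {s} (Γ : List T) (t t' : T) → Γ ⊢[ s ] t → (t' ∷ Γ) ⊢[ s ] t
  weakening Γ t t' = ⊢-covered (λ {u} m → u , there m , refl)

  convert-hyp : ∀ {s Γ u u' t} → u' =βη u → (u ∷ Γ) ⊢[ s ] t → (u' ∷ Γ) ⊢[ s ] t
  convert-hyp {u' = u'} e = ⊢-covered cover
    where
    cover : ∀ {v} → v ∈ _ → Σ[ v' ∈ T ] (v' ∈ (u' ∷ _) × v' =βη v)
    cover (here P.refl) = u' , here P.refl , e
    cover {v} (there m) = v , there m , refl

  K-β : (t u : T) → (K · t · u) =βη t
  K-β t u = trans (step (appˡ β)) (trans (step β) (≡⇒=βη (shift-[] t u)))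

  ⊃-unfold : (t₁ t₂ : T) → (t₁ ⊃ t₂) =βη (Ξ · (K · t₁) · (K · t₂))
  ⊃-unfold t₁ t₂ = trans (step (appˡ β)) (trans (step β)
    (≡⇒=βη (P.cong (λ z → Ξ · (K · z) · (K · t₂)) (shift-[] t₁ t₂))))

  H-unfold : (t : T) → (H · t) =βη (L · (K · t))
  H-unfold t = step β

  K-fresh : ∀ {x} (t : T) → Fresh x t → Fresh x (K · t)
  K-fresh t fr (inˡ (inλ (inλ ())))
  K-fresh t fr (inʳ f) = fr f

  module _ {s : System} where

    -- (Pₑ): instantiate Ξ(Kt₁)(Kt₂) at any argument, here Ξ.
    ⊃-elim : ∀ (Γ : List T) t₁ t₂ → Γ ⊢[ s ] (t₁ ⊃ t₂) → Γ ⊢[ s ] t₁ → Γ ⊢[ s ] t₂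
    ⊃-elim Γ t₁ t₂ d⊃ d₁ =
      Eq (Ξₑ {t₃ = Ξ} (Eq d⊃ (⊃-unfold t₁ t₂)) (Eq d₁ (sym (K-β t₁ Ξ)))) (K-β t₂ Ξ)

    module ⊃-Intro (Γ : List T) (t₁ t₂ : T) where

      x : ℕ
      x = ctxBound (t₁ ∷ t₂ ∷ Γ)

      fresh-x : All (Fresh x) (t₁ ∷ t₂ ∷ Γ)
      fresh-x = freshFor (t₁ ∷ t₂ ∷ Γ)

      fΓ : All (Fresh x) Γ
      fΓ = All.tail (All.tail fresh-x)

      fK₁ : Fresh x (K · t₁)
      fK₁ = K-fresh t₁ (All.head fresh-x)

      fK₂ : Fresh x (K · t₂)
      fK₂ = K-fresh t₂ (All.head (All.tail fresh-x))

      under-K : ∀ {t} → (t₁ ∷ Γ) ⊢[ s ] t → ((K · t₁ · var x) ∷ Γ) ⊢[ s ] t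
      under-K = convert-hyp (K-β t₁ (var x))

    ⊃-intro : ∀ (Γ : List T) t₁ t₂ → (t₁ ∷ Γ) ⊢[ s ] t₂ → Γ ⊢[ s ] (H · t₁) → Γ ⊢[ s ] (t₁ ⊃ t₂)
    ⊃-intro Γ t₁ t₂ d dH =
      Eq (Ξᵢ x fΓ fK₁ fK₂ (Eq (under-K d) (sym (K-β t₂ (var x)))) (Eq dH (H-unfold t₁)))
         (sym (⊃-unfold t₁ t₂))
      where open ⊃-Intro Γ t₁ t₂

    ⊃-H : ∀ (Γ : List T) t₁ t₂ → (t₁ ∷ Γ) ⊢[ s ] (H · t₂) → Γ ⊢[ s ] (H · t₁)
      → Γ ⊢[ s ] (H · (t₁ ⊃ t₂))
    ⊃-H Γ t₁ t₂ d dH =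
      Eq (Ξ_H x fΓ fK₁ fK₂ (Eq (under-K d) (appʳ-=βη H (sym (K-β t₂ (var x))))) (Eq dH (H-unfold t₁)))
         (appʳ-=βη H (sym (⊃-unfold t₁ t₂)))
      where open ⊃-Intro Γ t₁ t₂

mainTheorem6 : (n : ℕ) (C : Set) (s : System) →
    (∀ (Γ : Ctx {n} {C}) t₁ t₂ → Γ ⊢[ s ] (t₁ ⊃ t₂) → Γ ⊢[ s ] t₁ → Γ ⊢[ s ] t₂)
    × (∀ (Γ : Ctx {n} {C}) t₁ t₂ → (t₁ ∷ Γ) ⊢[ s ] t₂ → Γ ⊢[ s ] (H · t₁) → Γ ⊢[ s ] (t₁ ⊃ t₂))
    × (∀ (Γ : Ctx {n} {C}) t₁ t₂ → (t₁ ∷ Γ) ⊢[ s ] (H · t₂) → Γ ⊢[ s ] (H · t₁)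
        → Γ ⊢[ s ] (H · (t₁ ⊃ t₂)))
    × (∀ (Γ : Ctx {n} {C}) t t' → Γ ⊢[ s ] t → (t' ∷ Γ) ⊢[ s ] t)
mainTheorem6 n C s = ⊃-elim , ⊃-intro , ⊃-H , weakening
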